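{- Let $G$ be a finite simple graph on vertex set $\{x_1,\ldots,x_n\}$ and let $\pi=\{W_1,\ldots,W_t\}$ be a clique vertex partition of $G$. Let $G^\pi$ be the clique-whiskered graph with vertex set $\{x_1,\ldots,x_n,w_1,\ldots,w_t\}$ ($w_i$ new vertices) and edge set $E(G)\cup\{\{x,w_i\}: x\in W_i,\ 1\le i\le t\}$. Then $G^\pi$ is vertex decomposable and $\mathrm{Shed}(G^\pi)$ is a dominating set of $G^\pi$.
   Context: A clique vertex partition of $G$ is a partition of the vertex set into disjoint subsets $W_1,\ldots,W_t$ such that each induced subgraph $G[W_i]$ is a complete graph. For a graph $G=(V,E)$ and $x\in V$, $G\setminus x$ is the graph obtained by deleting $x$ and its incident edges; $N(x)$ is the set of neighbours of $x$, $N[x]=N(x)\cup\{x\}$, and $G\setminus N[x]$ is obtained by deleting all vertices of $N[x]$ and their incident edges. A graph is well-covered if all its maximal independent sets have the same cardinality. A graph $G$ is vertex decomposable if $G$ is well-covered and either (i) $G$ has no edges (possibly no vertices), or (ii) there is a vertex $x$ such that both $G\setminus x$ and $G\setminus N[x]$ are vertex decomposable. For a vertex decomposable graph $G$, $\mathrm{Shed}(G)$ is the set of vertices $x$ such that $G\setminus x$ and $G\setminus N[x]$ are both vertex decomposable. A set $D\subseteq V$ is dominating if every vertex of $V\setminus D$ is adjacent to a vertex of $D$. -}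

module Defs where

open import Data.Nat using (ℕ; _+_)
open import Data.Bool using (Bool; true; false; _∨_; _∧_)
open import Data.Fin using (Fin; splitAt; _≟_)
open import Data.Fin.Subset using (Subset; _∈_; _∉_; _⊆_; _∪_; _─_; _-_; ⁅_⁆; ∣_∣; ⊤)
open import Data.Vec using (tabulate)
open import Data.Sum using (_⊎_; inj₁; inj₂)
open import Data.Product using (_×_; Σ; ∃)
open import Relation.Binary.PropositionalEquality using (_≡_; _≢_)
open import Relation.Nullary using (¬_; ⌊_⌋)
open import Function.Definitions using (Surjective)

Adj : ℕ → Set
Adj m = Fin m → Fin m → Bool

record SimpleGraph (n : ℕ) : Set where
  field
    adj     : Adj n
    symm    : ∀ x y → adj x y ≡ adj y x
    irrefl  : ∀ x → adj x x ≡ false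
open SimpleGraph public

Edge : ∀ {m} → Adj m → Fin m → Fin m → Set
Edge a x y = a x y ≡ true

-- The (sub)graphs considered are induced subgraphs a[P] of a fixed graph a,
-- with vertex set P : Subset m.

Independent : ∀ {m} → Adj m → Subset m → Set
Independent a S = ∀ x y → x ∈ S → y ∈ S → ¬ Edge a x y

MaximalIndependent : ∀ {m} → Adj m → Subset m → Subset m → Set
MaximalIndependent a P S =
  S ⊆ P × Independent a S ×
  (∀ x → x ∈ P → x ∉ S → ¬ Independent a (S ∪ ⁅ x ⁆))

WellCovered : ∀ {m} → Adj m → Subset m → Set
WellCovered a P = ∀ S T → MaximalIndependent a P S → MaximalIndependent a P T → ∣ S ∣ ≡ ∣ T ∣

NoEdges : ∀ {m} → Adj m → Subset m → Set
NoEdges a P = ∀ x y → x ∈ P → y ∈ P → ¬ Edge a x y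

ClosedNbhd : ∀ {m} → Adj m → Fin m → Subset m
ClosedNbhd a x = tabulate (λ y → ⌊ y ≟ x ⌋ ∨ a x y)

delete : ∀ {m} → Subset m → Fin m → Subset m
delete P x = P - x

deleteNbhd : ∀ {m} → Adj m → Subset m → Fin m → Subset m
deleteNbhd a P x = P ─ ClosedNbhd a x

data VertexDecomposable {m} (a : Adj m) : Subset m → Set where
  edgeless : ∀ {P} → WellCovered a P → NoEdges a P → VertexDecomposable a P
  shed     : ∀ {P} → WellCovered a P → (x : Fin m) → x ∈ P →
             VertexDecomposable a (delete P x) →
             VertexDecomposable a (deleteNbhd a P x) →
             VertexDecomposable a P

InShed : ∀ {m} → Adj m → Subset m → Fin m → Set
InShed a P x = x ∈ P × VertexDecomposable a (delete P x) × VertexDecomposable a (deleteNbhd a P x)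

ShedDominating : ∀ {m} → Adj m → Subset m → Set
ShedDominating a P =
  ∀ y → y ∈ P → ¬ InShed a P y → ∃ λ x → InShed a P x × Edge a x y

-- Clique vertex partition {W_1..W_t}: block assignment c : Fin n → Fin t,
-- W_i = c⁻¹(i); blocks nonempty (c surjective) and each block is a clique.
IsCliquePartition : ∀ {n t} → SimpleGraph n → (Fin n → Fin t) → Set
IsCliquePartition G c =
  Surjective _≡_ _≡_ c ×
  (∀ x y → x ≢ y → c x ≡ c y → Edge (adj G) x y)

-- Clique-whiskered graph G^π on Fin (n + t): first n vertices are x_1..x_n,
-- last t are w_1..w_t; x ~ w_i iff c x = i.
whiskerAdj : ∀ {n t} → SimpleGraph n → (Fin n → Fin t) → Adj (n + t)
whiskerAdj {n} G c u v with splitAt n u | splitAt n v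
... | inj₁ x | inj₁ y = adj G x y
... | inj₁ x | inj₂ i = ⌊ c x ≟ i ⌋
... | inj₂ i | inj₁ y = ⌊ c y ≟ i ⌋
... | inj₂ i | inj₂ j = false

-- Let a block be a clique W_i together with its whisker w_i; the blocks partition the vertices of
-- G^π, and w_i is adjacent only to W_i.  On any vertex set P containing the whisker of each block
-- it meets, a maximal independent set meets every such block exactly once (two vertices of a block
-- are adjacent, and a missed block would let its whisker be added), so all maximal independent sets
-- of G^π[P] have as many elements as P meets blocks.  Deleting an original vertex x, or N[x], keeps
-- this closure property: a whisker adjacent to x lies in the block of x, which N[x] removes entirely.
-- Shedding the original vertices one by one thus ends in an edgeless set of whiskers, which makes
-- every original vertex a shedding vertex; a whisker w_i is dominated by any vertex of W_i ≠ ∅.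
module Submission where

open import Defs
open import Data.Nat using (ℕ; suc; _+_; _<_)
open import Data.Nat.Induction using (<-wellFounded)
open import Data.Bool using (Bool; true; false; _∨_)
open import Data.Fin using (Fin; zero; suc; _↑ˡ_; _↑ʳ_; splitAt; _≟_)
open import Data.Fin.Properties using (any?; suc-injective; splitAt-↑ˡ; splitAt-↑ʳ; splitAt⁻¹-↑ˡ; splitAt⁻¹-↑ʳ)
open import Data.Fin.Subset
open import Data.Fin.Subset.Properties
open import Data.Vec using ([]; _∷_; here; there; tabulate)
open import Data.Vec.Properties using ([]=⇒lookup; lookup⇒[]=; lookup∘tabulate)
open import Data.Product using (_×_; _,_; ∃)
open import Data.Sum using (_⊎_; inj₁; inj₂; [_,_]′)
open import Data.Empty using (⊥-elim)
open import Function using (_∘_; id)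
open import Induction.WellFounded using (Acc; acc)
open import Relation.Nullary using (Dec; ¬_; yes; no; ¬?; _×-dec_; ⌊_⌋)
open import Relation.Nullary.Decidable using (isYes≗does; dec-true; decidable-stable)
open import Relation.Binary.PropositionalEquality using (_≡_; _≢_; refl; sym; trans; cong; subst; module ≡-Reasoning)
open ≡-Reasoning

x∈p─q⇒x∉q : ∀ {m} (p q : Subset m) {x} → x ∈ p ─ q → x ∉ q
x∈p─q⇒x∉q (_ ∷ p) (true  ∷ q) {zero}  ()
x∈p─q⇒x∉q (_ ∷ p) (false ∷ q) {zero}  _          ()
x∈p─q⇒x∉q (_ ∷ p) (_     ∷ q) {suc x} (there x∈) (there x∈q) = x∈p─q⇒x∉q p q x∈ x∈q

∈-tabulate⁺ : ∀ {m} (f : Fin m → Bool) {x} → f x ≡ true → x ∈ tabulate f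
∈-tabulate⁺ f {x} fx = lookup⇒[]= x (tabulate f) (trans (lookup∘tabulate f x) fx)

∈-tabulate⁻ : ∀ {m} (f : Fin m → Bool) {x} → x ∈ tabulate f → f x ≡ true
∈-tabulate⁻ f {x} x∈ = trans (sym (lookup∘tabulate f x)) ([]=⇒lookup x∈)

∣⁅x⁆∪p∣≡1+∣p∣ : ∀ {m} (x : Fin m) (p : Subset m) → x ∉ p → ∣ ⁅ x ⁆ ∪ p ∣ ≡ suc ∣ p ∣
∣⁅x⁆∪p∣≡1+∣p∣ zero    (true  ∷ p) x∉p = ⊥-elim (x∉p here)
∣⁅x⁆∪p∣≡1+∣p∣ zero    (false ∷ p) x∉p = cong (suc ∘ ∣_∣) (∪-identityˡ p)
∣⁅x⁆∪p∣≡1+∣p∣ (suc x) (true  ∷ p) x∉p = cong suc (∣⁅x⁆∪p∣≡1+∣p∣ x p (x∉p ∘ there))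
∣⁅x⁆∪p∣≡1+∣p∣ (suc x) (false ∷ p) x∉p = ∣⁅x⁆∪p∣≡1+∣p∣ x p (x∉p ∘ there)

image : ∀ {m k} → (Fin m → Fin k) → Subset m → Subset k
image f []          = ⊥
image f (false ∷ p) = image (f ∘ suc) p
image f (true  ∷ p) = ⁅ f zero ⁆ ∪ image (f ∘ suc) p

∈-image⁺ : ∀ {m k} (f : Fin m → Fin k) {p x} → x ∈ p → f x ∈ image f p
∈-image⁺ f {true  ∷ p} here        = x∈p∪q⁺ (inj₁ (x∈⁅x⁆ (f zero)))
∈-image⁺ f {false ∷ p} (there x∈p) = ∈-image⁺ (f ∘ suc) x∈p
∈-image⁺ f {true  ∷ p} (there x∈p) = x∈p∪q⁺ {p = ⁅ f zero ⁆} (inj₂ (∈-image⁺ (f ∘ suc) x∈p))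

∈-image⁻ : ∀ {m k} (f : Fin m → Fin k) p {y} → y ∈ image f p → ∃ λ x → x ∈ p × f x ≡ y
∈-image⁻ f []          y∈ = ⊥-elim (∉⊥ y∈)
∈-image⁻ f (false ∷ p) y∈ with ∈-image⁻ (f ∘ suc) p y∈
... | x , x∈p , fx≡y = suc x , there x∈p , fx≡y
∈-image⁻ f (true  ∷ p) y∈ with x∈p∪q⁻ ⁅ f zero ⁆ (image (f ∘ suc) p) y∈
... | inj₁ y∈⁅f0⁆ = zero , here , sym (x∈⁅y⁆⇒x≡y (f zero) y∈⁅f0⁆)
... | inj₂ y∈img with ∈-image⁻ (f ∘ suc) p y∈img
...   | x , x∈p , fx≡y = suc x , there x∈p , fx≡y

image-mono : ∀ {m k} (f : Fin m → Fin k) {p q} → p ⊆ q → image f p ⊆ image f q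
image-mono f {p} p⊆q y∈ with ∈-image⁻ f p y∈
... | x , x∈p , refl = ∈-image⁺ f (p⊆q x∈p)

InjectiveOn : ∀ {m k} → (Fin m → Fin k) → Subset m → Set
InjectiveOn f p = ∀ {x y} → x ∈ p → y ∈ p → f x ≡ f y → x ≡ y

∣image∣≡∣p∣ : ∀ {m k} (f : Fin m → Fin k) p → InjectiveOn f p → ∣ image f p ∣ ≡ ∣ p ∣
∣image∣≡∣p∣ {k = k} f []          _   = ∣⊥∣≡0 k
∣image∣≡∣p∣         f (false ∷ p) inj =
  ∣image∣≡∣p∣ (f ∘ suc) p (λ x∈ y∈ e → suc-injective (inj (there x∈) (there y∈) e))
∣image∣≡∣p∣         f (true  ∷ p) inj =
  trans (∣⁅x⁆∪p∣≡1+∣p∣ (f zero) (image (f ∘ suc) p) f0∉)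
        (cong suc (∣image∣≡∣p∣ (f ∘ suc) p (λ x∈ y∈ e → suc-injective (inj (there x∈) (there y∈) e))))
  where
  f0∉ : f zero ∉ image (f ∘ suc) p
  f0∉ f0∈ with ∈-image⁻ (f ∘ suc) p f0∈
  ... | x , x∈p , e with inj (there x∈p) here e
  ...   | ()

module _ {m : ℕ} (a : Adj m) where

  ∈ClosedNbhd⁺ : ∀ {x y} → y ≡ x ⊎ Edge a x y → y ∈ ClosedNbhd a x
  ∈ClosedNbhd⁺ {x} {y} y≡x⊎xy = ∈-tabulate⁺ _ (bit (y ≟ x) y≡x⊎xy)
    where
    bit : (d : Dec (y ≡ x)) → y ≡ x ⊎ Edge a x y → (⌊ d ⌋ ∨ a x y) ≡ true
    bit (yes _) _           = refl
    bit (no y≢x) (inj₁ y≡x) = ⊥-elim (y≢x y≡x)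
    bit (no _)   (inj₂ xy)  = xy

  ∈ClosedNbhd⁻ : ∀ {x y} → y ∈ ClosedNbhd a x → y ≡ x ⊎ Edge a x y
  ∈ClosedNbhd⁻ {x} {y} y∈ with y ≟ x | ∈-tabulate⁻ _ y∈
  ... | yes y≡x | _  = inj₁ y≡x
  ... | no  _   | xy = inj₂ xy

module WhiskeredCliquePartition
  {m t : ℕ} (a : Adj m) (block : Fin m → Fin t) (whisker : Fin t → Fin m)
  (adj-sym : ∀ u v → a u v ≡ a v u)
  (adj-irrefl : ∀ u → a u u ≡ false)
  (block-whisker : ∀ i → block (whisker i) ≡ i)
  (block-clique : ∀ u v → u ≢ v → block u ≡ block v → Edge a u v)
  (whisker-nbr : ∀ i v → Edge a (whisker i) v → block v ≡ i)
  where

  IsWhisker : Fin m → Set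
  IsWhisker u = u ≡ whisker (block u)

  whisker-isWhisker : ∀ i → IsWhisker (whisker i)
  whisker-isWhisker i = cong whisker (sym (block-whisker i))

  whisker-nbrˡ : ∀ i v → Edge a v (whisker i) → block v ≡ i
  whisker-nbrˡ i v e = whisker-nbr i v (trans (adj-sym (whisker i) v) e)

  no-loop : ∀ u → ¬ Edge a u u
  no-loop u uu with trans (sym (adj-irrefl u)) uu
  ... | ()

  WhiskerClosed : Subset m → Set
  WhiskerClosed P = ∀ {u} → u ∈ P → whisker (block u) ∈ P

  independent-injectiveOn : ∀ {I} → Independent a I → InjectiveOn block I
  independent-injectiveOn ind {u} {v} u∈ v∈ same with u ≟ v
  ... | yes u≡v = u≡v
  ... | no  u≢v = ⊥-elim (ind u v u∈ v∈ (block-clique u v u≢v same))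

  independent-∪-whisker : ∀ {I} j → Independent a I → j ∉ image block I →
                          Independent a (I ∪ ⁅ whisker j ⁆)
  independent-∪-whisker {I} j ind j∉ u v u∈ v∈ uv
    with x∈p∪q⁻ I ⁅ whisker j ⁆ u∈ | x∈p∪q⁻ I ⁅ whisker j ⁆ v∈
  ... | inj₁ u∈I | inj₁ v∈I = ind u v u∈I v∈I uv
  ... | inj₁ u∈I | inj₂ v∈w rewrite x∈⁅y⁆⇒x≡y (whisker j) v∈w =
    j∉ (subst (_∈ image block I) (whisker-nbrˡ j u uv) (∈-image⁺ block u∈I))
  ... | inj₂ u∈w | inj₁ v∈I rewrite x∈⁅y⁆⇒x≡y (whisker j) u∈w =
    j∉ (subst (_∈ image block I) (whisker-nbr j v uv) (∈-image⁺ block v∈I))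
  ... | inj₂ u∈w | inj₂ v∈w rewrite x∈⁅y⁆⇒x≡y (whisker j) u∈w | x∈⁅y⁆⇒x≡y (whisker j) v∈w =
    no-loop (whisker j) uv

  maximalIndependent-meets-blocks : ∀ {P I} → WhiskerClosed P → MaximalIndependent a P I →
                                    image block I ≡ image block P
  maximalIndependent-meets-blocks {P} {I} closed (I⊆P , ind , maximal) =
    ⊆-antisym (image-mono block I⊆P) meets
    where
    meets : image block P ⊆ image block I
    meets {j} j∈ with j ∈? image block I
    ... | yes j∈I = j∈I
    ... | no  j∉I = ⊥-elim (maximal (whisker j) w∈P w∉I (independent-∪-whisker j ind j∉I))
      where
      w∈P : whisker j ∈ P
      w∈P with ∈-image⁻ block P j∈
      ... | u , u∈P , refl = closed u∈P
      w∉I : whisker j ∉ I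
      w∉I w∈I = j∉I (subst (_∈ image block I) (block-whisker j) (∈-image⁺ block w∈I))

  wellCovered : ∀ {P} → WhiskerClosed P → WellCovered a P
  wellCovered {P} closed S T S-max T-max = trans (card S S-max) (sym (card T T-max))
    where
    card : ∀ I → MaximalIndependent a P I → ∣ I ∣ ≡ ∣ image block P ∣
    card I I-max@(_ , ind , _) = trans (sym (∣image∣≡∣p∣ block I (independent-injectiveOn ind)))
                                       (cong ∣_∣ (maximalIndependent-meets-blocks closed I-max))

  noEdges-whiskers : ∀ {P} → (∀ {u} → u ∈ P → IsWhisker u) → NoEdges a P
  noEdges-whiskers whiskers u v u∈ v∈ uv = no-loop u (subst (Edge a u) v≡u uv)
    where
    v≡u : v ≡ u
    v≡u = begin
      v                    ≡⟨ whiskers v∈ ⟩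
      whisker (block v)    ≡⟨ cong whisker (whisker-nbr (block u) v (subst (λ w → Edge a w v) (whiskers u∈) uv)) ⟩
      whisker (block u)    ≡⟨ whiskers u∈ ⟨
      u                    ∎

  whiskerClosed-delete : ∀ {P u} → WhiskerClosed P → ¬ IsWhisker u → WhiskerClosed (delete P u)
  whiskerClosed-delete {P} {u} closed u-orig v∈ =
    x∈p∧x≢y⇒x∈p-y (closed (p─q⊆p P ⁅ u ⁆ v∈)) λ w≡u → u-orig (subst IsWhisker w≡u (whisker-isWhisker _))

  whiskerClosed-deleteNbhd : ∀ {P u} → WhiskerClosed P → ¬ IsWhisker u →
                             WhiskerClosed (deleteNbhd a P u)
  whiskerClosed-deleteNbhd {P} {u} closed u-orig {v} v∈ =
    x∈p∧x∉q⇒x∈p─q (closed (p─q⊆p P (ClosedNbhd a u) v∈)) w∉N[u]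
    where
    v∉N[u] : v ∉ ClosedNbhd a u
    v∉N[u] = x∈p─q⇒x∉q P (ClosedNbhd a u) v∈
    w∉N[u] : whisker (block v) ∉ ClosedNbhd a u
    w∉N[u] w∈ with ∈ClosedNbhd⁻ a w∈
    ... | inj₁ w≡u = u-orig (subst IsWhisker w≡u (whisker-isWhisker _))
    ... | inj₂ uw with v ≟ u
    ...   | yes v≡u = v∉N[u] (∈ClosedNbhd⁺ a (inj₁ v≡u))
    ...   | no  v≢u = v∉N[u] (∈ClosedNbhd⁺ a (inj₂ (block-clique u v (v≢u ∘ sym) (whisker-nbrˡ (block v) u uw))))

  vertexDecomposable-acc : ∀ P → Acc _<_ ∣ P ∣ → WhiskerClosed P → VertexDecomposable a P
  vertexDecomposable-acc P (acc smaller) closed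
    with any? (λ u → u ∈? P ×-dec ¬? (u ≟ whisker (block u)))
  ... | yes (u , u∈P , u-orig) =
    shed (wellCovered closed) u u∈P
      (vertexDecomposable-acc _ (smaller (x∈p⇒∣p-x∣<∣p∣ u∈P)) (whiskerClosed-delete closed u-orig))
      (vertexDecomposable-acc _ (smaller (p∩q≢∅⇒∣p─q∣<∣p∣ P _ (u , x∈p∩q⁺ (u∈P , ∈ClosedNbhd⁺ a (inj₁ refl)))))
                              (whiskerClosed-deleteNbhd closed u-orig))
  ... | no ∄orig =
    edgeless (wellCovered closed)
             (noEdges-whiskers λ {u} u∈P → decidable-stable (u ≟ _) (λ u-orig → ∄orig (u , u∈P , u-orig)))

  vertexDecomposable : ∀ {P} → WhiskerClosed P → VertexDecomposable a P
  vertexDecomposable {P} = vertexDecomposable-acc P (<-wellFounded ∣ P ∣)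

  nonWhisker-inShed : ∀ {P u} → WhiskerClosed P → u ∈ P → ¬ IsWhisker u → InShed a P u
  nonWhisker-inShed closed u∈P u-orig =
    u∈P , vertexDecomposable (whiskerClosed-delete closed u-orig)
        , vertexDecomposable (whiskerClosed-deleteNbhd closed u-orig)

  shedDominating : ∀ {P} → WhiskerClosed P →
                   (∀ {i} → whisker i ∈ P → ∃ λ u → u ∈ P × block u ≡ i × ¬ IsWhisker u) →
                   ShedDominating a P
  shedDominating {P} closed blocks-nontrivial y y∈P y∉Shed with y ≟ whisker (block y)
  ... | no  y-orig = ⊥-elim (y∉Shed (nonWhisker-inShed closed y∈P y-orig))
  ... | yes y-whisker with blocks-nontrivial (subst (_∈ P) y-whisker y∈P)
  ...   | u , u∈P , same , u-orig =
    u , nonWhisker-inShed closed u∈P u-orig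
      , block-clique u y (λ u≡y → u-orig (subst IsWhisker (sym u≡y) y-whisker)) same

↑ˡ≢↑ʳ : ∀ {n t} (x : Fin n) (i : Fin t) → x ↑ˡ t ≢ n ↑ʳ i
↑ˡ≢↑ʳ {n} {t} x i e with trans (sym (splitAt-↑ˡ n x t)) (trans (cong (splitAt n) e) (splitAt-↑ʳ n t i))
... | ()

module _ {n t : ℕ} (c : Fin n → Fin t) where

  whiskerBlock : Fin (n + t) → Fin t
  whiskerBlock u = [ c , id ]′ (splitAt n u)

  whiskerBlock-↑ˡ : ∀ x → whiskerBlock (x ↑ˡ t) ≡ c x
  whiskerBlock-↑ˡ x rewrite splitAt-↑ˡ n x t = refl

  whiskerBlock-↑ʳ : ∀ i → whiskerBlock (n ↑ʳ i) ≡ i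
  whiskerBlock-↑ʳ i rewrite splitAt-↑ʳ n t i = refl

module _ {n t : ℕ} (G : SimpleGraph n) (c : Fin n → Fin t) where

  whiskerAdj-sym : ∀ u v → whiskerAdj G c u v ≡ whiskerAdj G c v u
  whiskerAdj-sym u v with splitAt n u | splitAt n v
  ... | inj₁ x | inj₁ y = symm G x y
  ... | inj₁ _ | inj₂ _ = refl
  ... | inj₂ _ | inj₁ _ = refl
  ... | inj₂ _ | inj₂ _ = refl

  whiskerAdj-irrefl : ∀ u → whiskerAdj G c u u ≡ false
  whiskerAdj-irrefl u with splitAt n u
  ... | inj₁ x = irrefl G x
  ... | inj₂ _ = refl

  whiskerAdj-clique : IsCliquePartition G c →
                      ∀ u v → u ≢ v → whiskerBlock c u ≡ whiskerBlock c v → Edge (whiskerAdj G c) u v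
  whiskerAdj-clique (_ , W-clique) u v u≢v same with splitAt n u in eu | splitAt n v in ev
  ... | inj₁ x | inj₁ y = W-clique x y (λ x≡y → u≢v (begin
          u      ≡⟨ splitAt⁻¹-↑ˡ eu ⟨
          x ↑ˡ t ≡⟨ cong (_↑ˡ t) x≡y ⟩
          y ↑ˡ t ≡⟨ splitAt⁻¹-↑ˡ ev ⟩
          v      ∎)) same
  ... | inj₁ x | inj₂ i = trans (isYes≗does (c x ≟ i)) (dec-true (c x ≟ i) same)
  ... | inj₂ i | inj₁ y = trans (isYes≗does (c y ≟ i)) (dec-true (c y ≟ i) (sym same))
  ... | inj₂ i | inj₂ j = ⊥-elim (u≢v (begin
          u      ≡⟨ splitAt⁻¹-↑ʳ eu ⟨
          n ↑ʳ i ≡⟨ cong (n ↑ʳ_) same ⟩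
          n ↑ʳ j ≡⟨ splitAt⁻¹-↑ʳ ev ⟩
          v      ∎))

  whiskerAdj-whisker-nbr : ∀ i v → Edge (whiskerAdj G c) (n ↑ʳ i) v → whiskerBlock c v ≡ i
  whiskerAdj-whisker-nbr i v e rewrite splitAt-↑ʳ n t i with splitAt n v
  ... | inj₂ _ with () ← e
  ... | inj₁ y with c y ≟ i
  ...   | yes cy≡i = cy≡i
  ...   | no  _    with () ← e

theorem3p3 : (n t : ℕ) (G : SimpleGraph n) (c : Fin n → Fin t) →
    IsCliquePartition G c →
    VertexDecomposable (whiskerAdj G c) ⊤ × ShedDominating (whiskerAdj G c) ⊤
theorem3p3 n t G c π@(c-surjective , _) =
  vertexDecomposable (λ _ → ∈⊤) , shedDominating (λ _ → ∈⊤) blocks-nontrivial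
  where
  open WhiskeredCliquePartition (whiskerAdj G c) (whiskerBlock c) (n ↑ʳ_)
         (whiskerAdj-sym G c) (whiskerAdj-irrefl G c) (whiskerBlock-↑ʳ c)
         (whiskerAdj-clique G c π) (whiskerAdj-whisker-nbr G c)

  blocks-nontrivial : ∀ {i} → n ↑ʳ i ∈ ⊤ →
                      ∃ λ u → u ∈ ⊤ × whiskerBlock c u ≡ i × ¬ IsWhisker u
  blocks-nontrivial {i} _ with c-surjective i
  ... | x , cx≡i = x ↑ˡ t , ∈⊤ , trans (whiskerBlock-↑ˡ c x) (cx≡i refl) , ↑ˡ≢↑ʳ x _
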